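{- Let $\theta\ge0$, $\tau\in S_n$, and let $\hat\tau$ be the $\theta$-filtering of $\tau$. Then $\mathrm{mdev}(\hat\tau,\tau)\le 2\theta$ and \[ \mathrm{dev}(\hat\tau)\le 4\sum_{i\in[n]:\,|\tau(i)-i|>\theta}|\tau(i)-i|. \]
   Context: $[n]=\{1,\dots,n\}$, $S_n$ the permutations of $[n]$. For $\pi,\pi'\in S_n$, $\mathrm{mdev}(\pi,\pi')=\max_i|\pi(i)-\pi'(i)|$ and $\mathrm{dev}(\pi)=\sum_i|\pi(i)-i|$. The $\theta$-filtering of $\tau\in S_n$ is the permutation $\hat\tau\in S_n$ defined as follows: let $I=\{i\in[n]:|\tau(i)-i|>\theta\}$; then $\hat\tau(i)=\tau(i)$ for all $i\in I$, and $\hat\tau(i)<\hat\tau(j)$ for all $i,j\in[n]\setminus I$ with $i<j$ (i.e. the values $\{\tau(i):i\notin I\}$ are reassigned in increasing order to the indices in $[n]\setminus I$).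
   Formalization: The threshold θ of the θ-filtering ranges over the nonnegative rationals. -}

module Defs where

open import Data.Nat using (ℕ; _⊔_; ∣_-_∣)
open import Data.Fin using (Fin; toℕ)
import Data.Fin as F
open import Data.Fin.Permutation using (Permutation′; _⟨$⟩ʳ_)
open import Data.List using (List; map; foldr; allFin)
open import Data.Nat.ListAction using (sum)
open import Data.Integer using (+_)
open import Data.Rational using (ℚ; _/_; _<_; _<?_)
open import Data.Product using (_×_)
open import Relation.Nullary using (¬_; yes; no)
open import Relation.Binary.PropositionalEquality using (_≡_)

-- Permutations of [n] are bijections Fin n ↔ Fin n (0-based indices;
-- all quantities below only involve differences, so the shift is harmless).

ℕ→ℚ : ℕ → ℚ
ℕ→ℚ k = + k / 1

disp : {n : ℕ} → Permutation′ n → Fin n → ℕ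
disp π i = ∣ toℕ (π ⟨$⟩ʳ i) - toℕ i ∣

mdev : {n : ℕ} → Permutation′ n → Permutation′ n → ℕ
mdev {n} π π' = foldr _⊔_ 0 (map (λ i → ∣ toℕ (π ⟨$⟩ʳ i) - toℕ (π' ⟨$⟩ʳ i) ∣) (allFin n))

dev : {n : ℕ} → Permutation′ n → ℕ
dev {n} π = sum (map (disp π) (allFin n))

largeDevSum : {n : ℕ} → ℚ → Permutation′ n → ℕ
largeDevSum {n} θ τ = sum (map f (allFin n))
  where
  f : Fin n → ℕ
  f i with θ <? ℕ→ℚ (disp τ i)
  ... | yes _ = disp τ i
  ... | no  _ = 0

-- σ is the θ-filtering of τ:  I = {i : |τ(i)-i| > θ};  σ agrees with τ on I,
-- and σ is increasing on [n] \ I.  (Since σ is a permutation agreeing with τ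
-- on I, it maps [n] \ I onto {τ(i) : i ∉ I}; so this characterises τ̂ uniquely.)
IsFiltering : {n : ℕ} → ℚ → Permutation′ n → Permutation′ n → Set
IsFiltering θ τ σ =
  (∀ i → θ < ℕ→ℚ (disp τ i) → σ ⟨$⟩ʳ i ≡ τ ⟨$⟩ʳ i) ×
  (∀ i j → ¬ (θ < ℕ→ℚ (disp τ i)) → ¬ (θ < ℕ→ℚ (disp τ j)) →
     i F.< j → σ ⟨$⟩ʳ i F.< σ ⟨$⟩ʳ j)

{-# OPTIONS --safe #-}
-- Let S be the indices with |τ i - i| ≤ θ and D the largest displacement |τ i - i| over S.
-- Since τ̂ agrees with τ off S, both take the same set of values on S, and τ̂ is increasing
-- on S; so for i ∈ S there are as many j ∈ S with τ j < τ̂ i as there are j ∈ S with j < i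
-- (and likewise with ≤).  If τ̂ i > i + D, then every j ∈ S with j ≤ i has τ j ≤ j + D < τ̂ i,
-- one too many; symmetrically τ̂ i ≥ i - D.  Hence |τ̂ i - τ i| ≤ 2D ≤ 2θ.
--
-- For dev, |p - q| is the number of cuts x + ½ separating p and q.  A permutation moves as
-- many indices up across a cut as down.  Being increasing on S, τ̂ moves the indices of S
-- across a given cut in one direction only, so their crossings are balanced by those of the
-- indices outside S, where τ̂ = τ.  Summing over the cuts, Σ_{i ∈ S} |τ̂ i - i| is at most
-- Σ_{i ∉ S} |τ i - i|, and dev τ̂ ≤ 2 Σ_{i ∉ S} |τ i - i|.
module Submission where

open import Data.Bool.Base using (if_then_else_)
open import Data.Fin.Base as Fin using (Fin; toℕ)
open import Data.Fin.Properties using (toℕ<n; toℕ-injective; any?)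
open import Data.Fin.Permutation using (Permutation′; _⟨$⟩ʳ_)
import Data.Integer as ℤ
import Data.Integer.Properties as ℤₚ
open import Data.List.Base using (map; allFin; tabulate)
open import Data.List.Extrema.Nat using (max; xs≤max; argmax-all)
open import Data.List.Properties using (map-tabulate; foldr-preservesᵇ)
open import Data.List.Relation.Unary.All.Properties using (map⁺; map⁻; tabulate⁺; tabulate⁻)
open import Data.Nat.Base using (ℕ; zero; suc; _+_; _*_; _∸_; _≤_; _<_; z≤n; s≤s; ∣_-_∣)
import Data.Nat.Coprimality as Coprime
import Data.Nat.ListAction as List
open import Data.Nat.Properties
open import Data.Product.Base using (_×_; _,_)
open import Data.Rational as ℚ using (ℚ; 0ℚ; mkℚ)
import Data.Rational.Properties as ℚₚ
open import Data.Sum.Base using (_⊎_; inj₁; inj₂)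
open import Function.Base using (_∘_; id)
open import Level using (0ℓ)
open import Relation.Binary.Definitions using (tri<; tri≈; tri>)
open import Relation.Binary.PropositionalEquality
open import Relation.Nullary using (¬_; Dec; yes; no; does; _×-dec_; ¬?; contradiction)
open import Relation.Unary using (Pred; Decidable; ∁)
open import Relation.Unary.Properties using (∁?)
open import Algebra.Properties.CommutativeMonoid.Sum +-0-commutativeMonoid
  using (sum; sum-syntax; sum-cong-≗; ∑-distrib-+; ∑-comm; sum-permute; sum-replicate-zero)

open import Defs

𝟙 : ∀ {p} {P : Set p} → Dec P → ℕ
𝟙 P? = if does P? then 1 else 0

module _ {p q} {P : Set p} {Q : Set q} where

  𝟙-mono : (P → Q) → (P? : Dec P) (Q? : Dec Q) → 𝟙 P? ≤ 𝟙 Q?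
  𝟙-mono _   (no _)  _       = z≤n
  𝟙-mono _   (yes _) (yes _) = ≤-refl
  𝟙-mono P⇒Q (yes p) (no ¬q) = contradiction (P⇒Q p) ¬q

  𝟙-strict : ¬ P → Q → (P? : Dec P) (Q? : Dec Q) → 𝟙 P? < 𝟙 Q?
  𝟙-strict ¬p _ (yes p) _       = contradiction p ¬p
  𝟙-strict _  _ (no _)  (yes _) = s≤s z≤n
  𝟙-strict _  q (no _)  (no ¬q) = contradiction q ¬q

𝟙-cong : ∀ {p q} {P : Set p} {Q : Set q} → (P → Q) → (Q → P) →
         (P? : Dec P) (Q? : Dec Q) → 𝟙 P? ≡ 𝟙 Q?
𝟙-cong P⇒Q Q⇒P P? Q? = ≤-antisym (𝟙-mono P⇒Q P? Q?) (𝟙-mono Q⇒P Q? P?)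

𝟙-reject : ∀ {p} {P : Set p} → ¬ P → (P? : Dec P) → 𝟙 P? ≡ 0
𝟙-reject ¬p (yes p) = contradiction p ¬p
𝟙-reject _  (no _)  = refl

∑-mono-≤ : ∀ {n} {f g : Fin n → ℕ} → (∀ i → f i ≤ g i) → sum f ≤ sum g
∑-mono-≤ {zero}  _   = z≤n
∑-mono-≤ {suc n} f≤g = +-mono-≤ (f≤g Fin.zero) (∑-mono-≤ (f≤g ∘ Fin.suc))

∑-mono-< : ∀ {n} {f g : Fin n → ℕ} → (∀ i → f i ≤ g i) → ∀ i → f i < g i → sum f < sum g
∑-mono-< f≤g Fin.zero    f<g = +-mono-<-≤ f<g (∑-mono-≤ (f≤g ∘ Fin.suc))
∑-mono-< f≤g (Fin.suc i) f<g = +-mono-≤-< (f≤g Fin.zero) (∑-mono-< (f≤g ∘ Fin.suc) i f<g)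

restrict : ∀ {n ℓ} {U : Pred (Fin n) ℓ} → Decidable U → (Fin n → ℕ) → Fin n → ℕ
restrict U? f i = if does (U? i) then f i else 0

∑∈ : ∀ {n ℓ} {U : Pred (Fin n) ℓ} → Decidable U → (Fin n → ℕ) → ℕ
∑∈ U? f = sum (restrict U? f)

infixl 10 ∑∈
syntax ∑∈ U? (λ i → x) = ∑[ i ∈ U? ] x

module _ {n ℓ} {U : Pred (Fin n) ℓ} (U? : Decidable U) where

  restrict-∈ : ∀ {f : Fin n → ℕ} {i} → U i → restrict U? f i ≡ f i
  restrict-∈ {i = i} i∈U with U? i
  ... | yes _   = refl
  ... | no  i∉U = contradiction i∈U i∉U

  restrict-split : ∀ (f : Fin n → ℕ) i → f i ≡ restrict U? f i + restrict (∁? U?) f i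
  restrict-split f i with U? i
  ... | yes _ = sym (+-identityʳ (f i))
  ... | no  _ = refl

  restrict-cong : ∀ {f g : Fin n → ℕ} → (∀ i → U i → f i ≡ g i) →
                  ∀ i → restrict U? f i ≡ restrict U? g i
  restrict-cong f≡g i with U? i
  ... | yes i∈U = f≡g i i∈U
  ... | no  _   = refl

  restrict-zero : ∀ {f : Fin n → ℕ} → (∀ i → U i → f i ≡ 0) → ∀ i → restrict U? f i ≡ 0
  restrict-zero f≡0 i with U? i
  ... | yes i∈U = f≡0 i i∈U
  ... | no  _   = refl

  restrict-mono : ∀ {f g : Fin n → ℕ} → (∀ i → U i → f i ≤ g i) →
                  ∀ i → restrict U? f i ≤ restrict U? g i
  restrict-mono f≤g i with U? i
  ... | yes i∈U = f≤g i i∈U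
  ... | no  _   = z≤n

  restrict-+ : ∀ (f g : Fin n → ℕ) i →
               restrict U? (λ j → f j + g j) i ≡ restrict U? f i + restrict U? g i
  restrict-+ f g i with U? i
  ... | yes _ = refl
  ... | no  _ = refl

  restrict-∑ : ∀ {m} (f : Fin n → Fin m → ℕ) i →
    restrict U? (λ j → ∑[ x < m ] f j x) i ≡ ∑[ x < m ] restrict U? (λ j → f j x) i
  restrict-∑ {m} f i with U? i
  ... | yes _ = refl
  ... | no  _ = sym (sum-replicate-zero m)

  ∑-split : ∀ (f : Fin n → ℕ) → sum f ≡ ∑[ i ∈ U? ] f i + ∑[ i ∈ ∁? U? ] f i
  ∑-split f =
    trans (sum-cong-≗ (restrict-split f)) (∑-distrib-+ (restrict U? f) (restrict (∁? U?) f))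

  ∑∈-cong : ∀ {f g : Fin n → ℕ} → (∀ i → U i → f i ≡ g i) → ∑[ i ∈ U? ] f i ≡ ∑[ i ∈ U? ] g i
  ∑∈-cong f≡g = sum-cong-≗ (restrict-cong f≡g)

  ∑∈-zero : ∀ {f : Fin n → ℕ} → (∀ i → U i → f i ≡ 0) → ∑[ i ∈ U? ] f i ≡ 0
  ∑∈-zero f≡0 = trans (sum-cong-≗ (restrict-zero f≡0)) (sum-replicate-zero n)

  ∑∈-mono-≤ : ∀ {f g : Fin n → ℕ} → (∀ i → U i → f i ≤ g i) → ∑[ i ∈ U? ] f i ≤ ∑[ i ∈ U? ] g i
  ∑∈-mono-≤ f≤g = ∑-mono-≤ (restrict-mono f≤g)

  ∑∈-mono-< : ∀ {f g : Fin n → ℕ} {i} → (∀ i → U i → f i ≤ g i) → U i → f i < g i →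
    ∑[ i ∈ U? ] f i < ∑[ i ∈ U? ] g i
  ∑∈-mono-< {f} {g} {i} f≤g i∈U f<g =
    ∑-mono-< (restrict-mono f≤g) i
      (subst₂ _<_ (sym (restrict-∈ {f} i∈U)) (sym (restrict-∈ {g} i∈U)) f<g)

  ∑∈-distrib-+ : ∀ (f g : Fin n → ℕ) → ∑[ i ∈ U? ] (f i + g i) ≡ ∑[ i ∈ U? ] f i + ∑[ i ∈ U? ] g i
  ∑∈-distrib-+ f g =
    trans (sum-cong-≗ (restrict-+ f g)) (∑-distrib-+ (restrict U? f) (restrict U? g))

  ∑∈-comm : ∀ {m} (f : Fin n → Fin m → ℕ) →
    ∑[ i ∈ U? ] ∑[ x < m ] f i x ≡ ∑[ x < m ] ∑[ i ∈ U? ] f i x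
  ∑∈-comm f = trans (sum-cong-≗ (restrict-∑ f)) (∑-comm (λ i x → restrict U? (λ j → f j x) i))

∑-∁-values-agree : ∀ {n ℓ} {L : Pred (Fin n) ℓ} (L? : Decidable L) (τ σ : Permutation′ n) →
  (∀ i → L i → σ ⟨$⟩ʳ i ≡ τ ⟨$⟩ʳ i) → (h : Fin n → ℕ) →
  ∑[ i ∈ ∁? L? ] h (σ ⟨$⟩ʳ i) ≡ ∑[ i ∈ ∁? L? ] h (τ ⟨$⟩ʳ i)
∑-∁-values-agree L? τ σ agree h = +-cancelˡ-≡ (∑[ i ∈ L? ] h (τ ⟨$⟩ʳ i)) _ _ (begin
  ∑[ i ∈ L? ] h (τ ⟨$⟩ʳ i) + ∑[ i ∈ ∁? L? ] h (σ ⟨$⟩ʳ i)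
    ≡⟨ cong (_+ _) (∑∈-cong L? (λ i i∈L → cong h (agree i i∈L))) ⟨
  ∑[ i ∈ L? ] h (σ ⟨$⟩ʳ i) + ∑[ i ∈ ∁? L? ] h (σ ⟨$⟩ʳ i)
    ≡⟨ ∑-split L? (h ∘ (σ ⟨$⟩ʳ_)) ⟨
  ∑[ i < _ ] h (σ ⟨$⟩ʳ i)  ≡⟨ sum-permute h σ ⟨
  ∑[ i < _ ] h i           ≡⟨ sum-permute h τ ⟩
  ∑[ i < _ ] h (τ ⟨$⟩ʳ i)  ≡⟨ ∑-split L? (h ∘ (τ ⟨$⟩ʳ_)) ⟩
  ∑[ i ∈ L? ] h (τ ⟨$⟩ʳ i) + ∑[ i ∈ ∁? L? ] h (τ ⟨$⟩ʳ i) ∎)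
  where open ≡-Reasoning

∣m-n∣≡m∸n+n∸m : ∀ m n → ∣ m - n ∣ ≡ m ∸ n + (n ∸ m)
∣m-n∣≡m∸n+n∸m zero    zero    = refl
∣m-n∣≡m∸n+n∸m zero    (suc n) = refl
∣m-n∣≡m∸n+n∸m (suc m) zero    = sym (+-identityʳ (suc m))
∣m-n∣≡m∸n+n∸m (suc m) (suc n) = ∣m-n∣≡m∸n+n∸m m n

m≤n+o∧n≤m+o⇒∣m-n∣≤o : ∀ {m n o} → m ≤ n + o → n ≤ m + o → ∣ m - n ∣ ≤ o
m≤n+o∧n≤m+o⇒∣m-n∣≤o {zero}  {zero}  _   _   = z≤n
m≤n+o∧n≤m+o⇒∣m-n∣≤o {zero}  {suc n} _   n≤o = n≤o
m≤n+o∧n≤m+o⇒∣m-n∣≤o {suc m} {zero}  m≤o _   = m≤o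
m≤n+o∧n≤m+o⇒∣m-n∣≤o {suc m} {suc n} (s≤s m≤n+o) (s≤s n≤m+o) = m≤n+o∧n≤m+o⇒∣m-n∣≤o m≤n+o n≤m+o

one-sided-balance : ∀ {u d U D} → u + U ≡ d + D → U ≡ 0 ⊎ D ≡ 0 → U + D ≤ u + d
one-sided-balance {u} {d} {D = D} balance (inj₁ refl) = begin
  D      ≤⟨ m≤n+m D d ⟩
  d + D  ≡⟨ balance ⟨
  u + 0  ≡⟨ +-identityʳ u ⟩
  u      ≤⟨ m≤m+n u d ⟩
  u + d  ∎
  where open ≤-Reasoning
one-sided-balance {u} {d} {U} balance (inj₂ refl) = begin
  U + 0  ≡⟨ +-identityʳ U ⟩
  U      ≤⟨ m≤n+m U u ⟩
  u + U  ≡⟨ balance ⟩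
  d + 0  ≡⟨ +-identityʳ d ⟩
  d      ≤⟨ m≤n+m d u ⟩
  u + d  ∎
  where open ≤-Reasoning

-- p ≤ x < q, phrased through x < _ alone so that the indicators below compute from
-- x <ᵇ p and x <ᵇ q; this makes ∑-crosses and crossing-balance hold by computation.
Crosses : ℕ → ℕ → ℕ → Set
Crosses x p q = x < q × ¬ x < p

crosses? : ∀ x p q → Dec (Crosses x p q)
crosses? x p q = x <? q ×-dec ¬? (x <? p)

crossings : ℕ → ℕ → ℕ → ℕ
crossings x p q = 𝟙 (crosses? x q p) + 𝟙 (crosses? x p q)

∑-crosses : ∀ {n} p q → q ≤ n → ∑[ x < n ] 𝟙 (crosses? (toℕ x) p q) ≡ q ∸ p
∑-crosses {zero}  p       _       z≤n       = sym (0∸n≡0 p)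
∑-crosses {suc n} p       zero    _         = ∑-crosses {n} p zero z≤n
∑-crosses {suc n} zero    (suc q) (s≤s q≤n) = cong suc (∑-crosses {n} zero q q≤n)
∑-crosses {suc n} (suc p) (suc q) (s≤s q≤n) = ∑-crosses {n} p q q≤n

∑-crossings : ∀ {n} p q → p ≤ n → q ≤ n → ∑[ x < n ] crossings (toℕ x) p q ≡ ∣ p - q ∣
∑-crossings {n} p q p≤n q≤n = begin
  ∑[ x < n ] crossings (toℕ x) p q
    ≡⟨ ∑-distrib-+ {n} (down ∘ toℕ) (up ∘ toℕ) ⟩
  ∑[ x < n ] down (toℕ x) + ∑[ x < n ] up (toℕ x)
    ≡⟨ cong₂ _+_ (∑-crosses {n} q p p≤n) (∑-crosses {n} p q q≤n) ⟩
  p ∸ q + (q ∸ p)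
    ≡⟨ ∣m-n∣≡m∸n+n∸m p q ⟨
  ∣ p - q ∣ ∎
  where
  open ≡-Reasoning
  up down : ℕ → ℕ
  up x   = 𝟙 (crosses? x p q)
  down x = 𝟙 (crosses? x q p)

crossing-balance : ∀ x p q → 𝟙 (x <? p) + 𝟙 (crosses? x p q) ≡ 𝟙 (x <? q) + 𝟙 (crosses? x q p)
crossing-balance x p q = balance (x <? p) (x <? q)
  where
  balance : ∀ {a b} {A : Set a} {B : Set b} (A? : Dec A) (B? : Dec B) →
    𝟙 A? + 𝟙 (B? ×-dec ¬? A?) ≡ 𝟙 B? + 𝟙 (A? ×-dec ¬? B?)
  balance (yes _) (yes _) = refl
  balance (yes _) (no  _) = refl
  balance (no  _) (yes _) = refl
  balance (no  _) (no  _) = refl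

upcrossings≡downcrossings : ∀ {n} (π : Permutation′ n) x →
  ∑[ i < n ] 𝟙 (crosses? x (toℕ i) (toℕ (π ⟨$⟩ʳ i))) ≡
  ∑[ i < n ] 𝟙 (crosses? x (toℕ (π ⟨$⟩ʳ i)) (toℕ i))
upcrossings≡downcrossings {n} π x = +-cancelˡ-≡ (∑[ i < n ] below i) _ _ (begin
  ∑[ i < n ] below i + ∑[ i < n ] up i
    ≡⟨ ∑-distrib-+ below up ⟨
  ∑[ i < n ] (below i + up i)
    ≡⟨ sum-cong-≗ (λ i → crossing-balance x (toℕ i) (πₙ i)) ⟩
  ∑[ i < n ] (below (π ⟨$⟩ʳ i) + down i)
    ≡⟨ ∑-distrib-+ (below ∘ (π ⟨$⟩ʳ_)) down ⟩
  ∑[ i < n ] below (π ⟨$⟩ʳ i) + ∑[ i < n ] down i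
    ≡⟨ cong (_+ ∑[ i < n ] down i) (sum-permute below π) ⟨
  ∑[ i < n ] below i + ∑[ i < n ] down i ∎)
  where
  open ≡-Reasoning
  πₙ below up down : Fin n → ℕ
  πₙ i    = toℕ (π ⟨$⟩ʳ i)
  below i = 𝟙 (x <? toℕ i)
  up i    = 𝟙 (crosses? x (toℕ i) (πₙ i))
  down i  = 𝟙 (crosses? x (πₙ i) (toℕ i))

module Filtering {n ℓ} {L : Pred (Fin n) ℓ} (L? : Decidable L) (τ σ : Permutation′ n)
  (agree : ∀ i → L i → σ ⟨$⟩ʳ i ≡ τ ⟨$⟩ʳ i)
  (sorted : ∀ i j → ¬ L i → ¬ L j → i Fin.< j → σ ⟨$⟩ʳ i Fin.< σ ⟨$⟩ʳ j) where

  S? : Decidable (∁ L)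
  S? = ∁? L?

  σₙ τₙ : Fin n → ℕ
  σₙ i = toℕ (σ ⟨$⟩ʳ i)
  τₙ i = toℕ (τ ⟨$⟩ʳ i)

  sorted-reflects : ∀ {i j} → ¬ L i → ¬ L j → σₙ i < σₙ j → toℕ i < toℕ j
  sorted-reflects {i} {j} i∉L j∉L σi<σj with <-cmp (toℕ i) (toℕ j)
  ... | tri< i<j _ _ = i<j
  ... | tri≈ _ i≡j _ = contradiction σi<σj (<-irrefl (cong (toℕ ∘ (σ ⟨$⟩ʳ_)) (toℕ-injective i≡j)))
  ... | tri> _ _ j<i = contradiction σi<σj (<-asym (sorted j i j∉L i∉L j<i))

  sorted-reflects-≤ : ∀ {i j} → ¬ L i → ¬ L j → σₙ i ≤ σₙ j → toℕ i ≤ toℕ j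
  sorted-reflects-≤ i∉L j∉L σi≤σj = ≮⇒≥ (λ j<i → <⇒≱ (sorted _ _ j∉L i∉L j<i) σi≤σj)

  sorted-≤ : ∀ {i j} → ¬ L i → ¬ L j → toℕ i ≤ toℕ j → σₙ i ≤ σₙ j
  sorted-≤ i∉L j∉L i≤j = ≮⇒≥ (λ σj<σi → <⇒≱ (sorted-reflects j∉L i∉L σj<σi) i≤j)

  rank : ∀ {r} {R : ℕ → ℕ → Set r} (R? : ∀ a b → Dec (R a b)) {i} →
    (∀ {j} → ¬ L j → R (σₙ j) (σₙ i) → R (toℕ j) (toℕ i)) →
    (∀ {j} → ¬ L j → R (toℕ j) (toℕ i) → R (σₙ j) (σₙ i)) →
    ∑[ j ∈ S? ] 𝟙 (R? (τₙ j) (σₙ i)) ≡ ∑[ j ∈ S? ] 𝟙 (R? (toℕ j) (toℕ i))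
  rank R? {i} reflects preserves = begin
    ∑[ j ∈ S? ] 𝟙 (R? (τₙ j) (σₙ i))
      ≡⟨ ∑-∁-values-agree L? τ σ agree (λ v → 𝟙 (R? (toℕ v) (σₙ i))) ⟨
    ∑[ j ∈ S? ] 𝟙 (R? (σₙ j) (σₙ i))
      ≡⟨ ∑∈-cong S? order ⟩
    ∑[ j ∈ S? ] 𝟙 (R? (toℕ j) (toℕ i)) ∎
    where
    open ≡-Reasoning
    order : ∀ j → ¬ L j → 𝟙 (R? (σₙ j) (σₙ i)) ≡ 𝟙 (R? (toℕ j) (toℕ i))
    order j j∉L = 𝟙-cong (reflects j∉L) (preserves j∉L) (R? (σₙ j) (σₙ i)) (R? (toℕ j) (toℕ i))

  rank-< : ∀ {i} → ¬ L i → ∑[ j ∈ S? ] 𝟙 (τₙ j <? σₙ i) ≡ ∑[ j ∈ S? ] 𝟙 (toℕ j <? toℕ i)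
  rank-< i∉L = rank _<?_ (λ j∉L → sorted-reflects j∉L i∉L) (λ j∉L → sorted _ _ j∉L i∉L)

  rank-≤ : ∀ {i} → ¬ L i → ∑[ j ∈ S? ] 𝟙 (τₙ j ≤? σₙ i) ≡ ∑[ j ∈ S? ] 𝟙 (toℕ j ≤? toℕ i)
  rank-≤ i∉L = rank _≤?_ (λ j∉L → sorted-reflects-≤ j∉L i∉L) (λ j∉L → sorted-≤ j∉L i∉L)

  rank-gap : ∀ {i} → ¬ L i → ∑[ j ∈ S? ] 𝟙 (toℕ j <? toℕ i) < ∑[ j ∈ S? ] 𝟙 (toℕ j ≤? toℕ i)
  rank-gap {i} i∉L = ∑∈-mono-< S?
    (λ j _ → 𝟙-mono <⇒≤ (toℕ j <? toℕ i) (toℕ j ≤? toℕ i)) i∉L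
    (𝟙-strict (<-irrefl refl) ≤-refl (toℕ i <? toℕ i) (toℕ i ≤? toℕ i))

  module _ {D : ℕ} (small-disp≤D : ∀ j → ¬ L j → disp τ j ≤ D) where

    σ≤i+D : ∀ {i} → ¬ L i → σₙ i ≤ toℕ i + D
    σ≤i+D {i} i∉L = ≮⇒≥ too-high
      where
      too-high : ¬ (toℕ i + D < σₙ i)
      too-high i+D<σi = <-irrefl refl (begin-strict
        ∑[ j ∈ S? ] 𝟙 (toℕ j ≤? toℕ i)
          ≤⟨ ∑∈-mono-≤ S? (λ j j∉L → 𝟙-mono (τ<σi j∉L) (toℕ j ≤? toℕ i) (τₙ j <? σₙ i)) ⟩
        ∑[ j ∈ S? ] 𝟙 (τₙ j <? σₙ i)    ≡⟨ rank-< i∉L ⟩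
        ∑[ j ∈ S? ] 𝟙 (toℕ j <? toℕ i)  <⟨ rank-gap i∉L ⟩
        ∑[ j ∈ S? ] 𝟙 (toℕ j ≤? toℕ i)  ∎)
        where
        open ≤-Reasoning
        τ<σi : ∀ {j} → ¬ L j → toℕ j ≤ toℕ i → τₙ j < σₙ i
        τ<σi {j} j∉L j≤i = begin-strict
          τₙ j              ≤⟨ m≤n+∣m-n∣ (τₙ j) (toℕ j) ⟩
          toℕ j + disp τ j  ≤⟨ +-mono-≤ j≤i (small-disp≤D j j∉L) ⟩
          toℕ i + D         <⟨ i+D<σi ⟩
          σₙ i              ∎

    i≤σ+D : ∀ {i} → ¬ L i → toℕ i ≤ σₙ i + D
    i≤σ+D {i} i∉L = ≮⇒≥ too-low
      where
      too-low : ¬ (σₙ i + D < toℕ i)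
      too-low σ+D<i = <-irrefl refl (begin-strict
        ∑[ j ∈ S? ] 𝟙 (toℕ j ≤? toℕ i)  ≡⟨ rank-≤ i∉L ⟨
        ∑[ j ∈ S? ] 𝟙 (τₙ j ≤? σₙ i)
          ≤⟨ ∑∈-mono-≤ S? (λ j j∉L → 𝟙-mono (j<i j∉L) (τₙ j ≤? σₙ i) (toℕ j <? toℕ i)) ⟩
        ∑[ j ∈ S? ] 𝟙 (toℕ j <? toℕ i)  <⟨ rank-gap i∉L ⟩
        ∑[ j ∈ S? ] 𝟙 (toℕ j ≤? toℕ i)  ∎)
        where
        open ≤-Reasoning
        j<i : ∀ {j} → ¬ L j → τₙ j ≤ σₙ i → toℕ j < toℕ i
        j<i {j} j∉L τj≤σi = begin-strict
          toℕ j             ≤⟨ m≤n+∣n-m∣ (toℕ j) (τₙ j) ⟩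
          τₙ j + disp τ j   ≤⟨ +-mono-≤ τj≤σi (small-disp≤D j j∉L) ⟩
          σₙ i + D          <⟨ σ+D<i ⟩
          toℕ i             ∎

    σ-near-τ : ∀ i → ∣ σₙ i - τₙ i ∣ ≤ D + D
    σ-near-τ i with L? i
    ... | yes i∈L = subst (_≤ D + D) (sym (m≡n⇒∣m-n∣≡0 (cong toℕ (agree i i∈L)))) z≤n
    ... | no  i∉L = begin
      ∣ σₙ i - τₙ i ∣
        ≤⟨ ∣-∣-triangle (σₙ i) (toℕ i) (τₙ i) ⟩
      ∣ σₙ i - toℕ i ∣ + ∣ toℕ i - τₙ i ∣
        ≤⟨ +-monoˡ-≤ _ (m≤n+o∧n≤m+o⇒∣m-n∣≤o (σ≤i+D i∉L) (i≤σ+D i∉L)) ⟩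
      D + ∣ toℕ i - τₙ i ∣
        ≡⟨ cong (D +_) (∣-∣-comm (toℕ i) (τₙ i)) ⟩
      D + disp τ i
        ≤⟨ +-monoʳ-≤ D (small-disp≤D i i∉L) ⟩
      D + D ∎
      where open ≤-Reasoning

  no-opposite-crossings : ∀ {x i j} → ¬ L i → ¬ L j →
    Crosses x (toℕ i) (σₙ i) → ¬ Crosses x (σₙ j) (toℕ j)
  no-opposite-crossings {x} {i} {j} i∉L j∉L (x<σi , x≮i) (x<j , x≮σj) = <-irrefl refl (begin-strict
    σₙ i  <⟨ sorted i j i∉L j∉L (≤-<-trans (≮⇒≥ x≮i) x<j) ⟩
    σₙ j  ≤⟨ ≮⇒≥ x≮σj ⟩
    x     <⟨ x<σi ⟩
    σₙ i  ∎)
    where open ≤-Reasoning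

  crossings-one-way : ∀ x →
    ∑[ i ∈ S? ] 𝟙 (crosses? x (toℕ i) (σₙ i)) ≡ 0 ⊎ ∑[ i ∈ S? ] 𝟙 (crosses? x (σₙ i) (toℕ i)) ≡ 0
  crossings-one-way x with any? (λ i → S? i ×-dec crosses? x (toℕ i) (σₙ i))
  ... | yes (i , i∉L , up) = inj₂ (∑∈-zero S? (λ j j∉L →
          𝟙-reject (no-opposite-crossings i∉L j∉L up) (crosses? x (σₙ j) (toℕ j))))
  ... | no  no-up          = inj₁ (∑∈-zero S? (λ i i∉L →
          𝟙-reject (λ up → no-up (i , i∉L , up)) (crosses? x (toℕ i) (σₙ i))))

  crossings-small≤large : ∀ x →
    ∑[ i ∈ S? ] crossings x (σₙ i) (toℕ i) ≤ ∑[ i ∈ L? ] crossings x (τₙ i) (toℕ i)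
  crossings-small≤large x = begin
    ∑[ i ∈ S? ] crossings x (σₙ i) (toℕ i)
      ≡⟨ ∑∈-distrib-+ S? (up σ) (down σ) ⟩
    ∑[ i ∈ S? ] up σ i + ∑[ i ∈ S? ] down σ i
      ≤⟨ one-sided-balance balance (crossings-one-way x) ⟩
    ∑[ i ∈ L? ] up τ i + ∑[ i ∈ L? ] down τ i
      ≡⟨ ∑∈-distrib-+ L? (up τ) (down τ) ⟨
    ∑[ i ∈ L? ] crossings x (τₙ i) (toℕ i) ∎
    where
    open ≤-Reasoning
    up down : Permutation′ n → Fin n → ℕ
    up   π i = 𝟙 (crosses? x (toℕ i) (toℕ (π ⟨$⟩ʳ i)))
    down π i = 𝟙 (crosses? x (toℕ (π ⟨$⟩ʳ i)) (toℕ i))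
    up-agree : ∀ i → L i → up σ i ≡ up τ i
    up-agree i i∈L = cong (λ k → 𝟙 (crosses? x (toℕ i) (toℕ k))) (agree i i∈L)
    down-agree : ∀ i → L i → down σ i ≡ down τ i
    down-agree i i∈L = cong (λ k → 𝟙 (crosses? x (toℕ k) (toℕ i))) (agree i i∈L)
    balance : ∑[ i ∈ L? ] up τ i + ∑[ i ∈ S? ] up σ i ≡ ∑[ i ∈ L? ] down τ i + ∑[ i ∈ S? ] down σ i
    balance = begin-equality
      ∑[ i ∈ L? ] up τ i + ∑[ i ∈ S? ] up σ i
        ≡⟨ cong (_+ ∑[ i ∈ S? ] up σ i) (∑∈-cong L? up-agree) ⟨
      ∑[ i ∈ L? ] up σ i + ∑[ i ∈ S? ] up σ i
        ≡⟨ ∑-split L? (up σ) ⟨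
      ∑[ i < n ] up σ i
        ≡⟨ upcrossings≡downcrossings σ x ⟩
      ∑[ i < n ] down σ i
        ≡⟨ ∑-split L? (down σ) ⟩
      ∑[ i ∈ L? ] down σ i + ∑[ i ∈ S? ] down σ i
        ≡⟨ cong (_+ ∑[ i ∈ S? ] down σ i) (∑∈-cong L? down-agree) ⟩
      ∑[ i ∈ L? ] down τ i + ∑[ i ∈ S? ] down σ i ∎

  ∑-small-disp≤∑-large-disp : ∑[ i ∈ S? ] disp σ i ≤ ∑[ i ∈ L? ] disp τ i
  ∑-small-disp≤∑-large-disp = begin
    ∑[ i ∈ S? ] disp σ i
      ≡⟨ ∑∈-cong S? (λ i _ → as-crossings σ i) ⟨
    ∑[ i ∈ S? ] ∑[ x < n ] crossings (toℕ x) (σₙ i) (toℕ i)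
      ≡⟨ ∑∈-comm S? {n} (λ i x → crossings (toℕ x) (σₙ i) (toℕ i)) ⟩
    ∑[ x < n ] ∑[ i ∈ S? ] crossings (toℕ x) (σₙ i) (toℕ i)
      ≤⟨ ∑-mono-≤ {n} (λ x → crossings-small≤large (toℕ x)) ⟩
    ∑[ x < n ] ∑[ i ∈ L? ] crossings (toℕ x) (τₙ i) (toℕ i)
      ≡⟨ ∑∈-comm L? {n} (λ i x → crossings (toℕ x) (τₙ i) (toℕ i)) ⟨
    ∑[ i ∈ L? ] ∑[ x < n ] crossings (toℕ x) (τₙ i) (toℕ i)
      ≡⟨ ∑∈-cong L? (λ i _ → as-crossings τ i) ⟩
    ∑[ i ∈ L? ] disp τ i ∎
    where
    open ≤-Reasoning
    as-crossings : ∀ π i → ∑[ x < n ] crossings (toℕ x) (toℕ (π ⟨$⟩ʳ i)) (toℕ i) ≡ disp π i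
    as-crossings π i = ∑-crossings _ _ (<⇒≤ (toℕ<n (π ⟨$⟩ʳ i))) (<⇒≤ (toℕ<n i))

  ∑-disp-σ≤2∑-large-disp : ∑[ i < n ] disp σ i ≤ 2 * ∑[ i ∈ L? ] disp τ i
  ∑-disp-σ≤2∑-large-disp = begin
    ∑[ i < n ] disp σ i
      ≡⟨ ∑-split L? (disp σ) ⟩
    ∑[ i ∈ L? ] disp σ i + ∑[ i ∈ S? ] disp σ i
      ≡⟨ cong (_+ ∑[ i ∈ S? ] disp σ i) (∑∈-cong L? disp-agree) ⟩
    Λ + ∑[ i ∈ S? ] disp σ i
      ≤⟨ +-monoʳ-≤ Λ ∑-small-disp≤∑-large-disp ⟩
    Λ + Λ
      ≡⟨ cong (Λ +_) (+-identityʳ Λ) ⟨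
    2 * Λ ∎
    where
    open ≤-Reasoning
    Λ : ℕ
    Λ = ∑[ i ∈ L? ] disp τ i
    disp-agree : ∀ i → L i → disp σ i ≡ disp τ i
    disp-agree i i∈L = cong (λ k → ∣ toℕ k - toℕ i ∣) (agree i i∈L)

sum-tabulate : ∀ {n} (f : Fin n → ℕ) → List.sum (tabulate f) ≡ ∑[ i < n ] f i
sum-tabulate {zero}  f = refl
sum-tabulate {suc n} f = cong (f Fin.zero +_) (sum-tabulate (f ∘ Fin.suc))

sum-map-allFin : ∀ {n} (f : Fin n → ℕ) → List.sum (map f (allFin n)) ≡ ∑[ i < n ] f i
sum-map-allFin f = trans (cong List.sum (map-tabulate id f)) (sum-tabulate f)

mdev≤ : ∀ {n c} (π π′ : Permutation′ n) →
  (∀ i → ∣ toℕ (π ⟨$⟩ʳ i) - toℕ (π′ ⟨$⟩ʳ i) ∣ ≤ c) → mdev π π′ ≤ c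
mdev≤ {c = c} π π′ bound = foldr-preservesᵇ {P = _≤ c} ⊔-lub z≤n (map⁺ (tabulate⁺ bound))

ℕ→ℚ≡mkℚ : ∀ m → ℕ→ℚ m ≡ mkℚ (ℤ.+ m) 0 (Coprime.sym (Coprime.1-coprimeTo m))
ℕ→ℚ≡mkℚ m = ℚₚ.normalize-coprime (Coprime.sym (Coprime.1-coprimeTo m))

ℕ→ℚ-mono-≤ : ∀ {m n} → m ≤ n → ℕ→ℚ m ℚ.≤ ℕ→ℚ n
ℕ→ℚ-mono-≤ {m} {n} m≤n rewrite ℕ→ℚ≡mkℚ m | ℕ→ℚ≡mkℚ n =
  ℚ.*≤* (ℤₚ.*-monoʳ-≤-nonNeg (ℤ.+ 1) (ℤ.+≤+ m≤n))

ℕ→ℚ-homo-* : ∀ m n → ℕ→ℚ (m * n) ≡ ℕ→ℚ m ℚ.* ℕ→ℚ n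
ℕ→ℚ-homo-* m n rewrite ℕ→ℚ≡mkℚ m | ℕ→ℚ≡mkℚ n = ℚₚ./-cong (ℤₚ.pos-* m n) refl

module _ {n} (θ : ℚ) (τ : Permutation′ n) where

  Large : Pred (Fin n) 0ℓ
  Large i = θ ℚ.< ℕ→ℚ (disp τ i)

  large? : Decidable Large
  large? i = θ ℚ.<? ℕ→ℚ (disp τ i)

  maxSmallDisp : ℕ
  maxSmallDisp = max 0 (map (restrict (∁? large?) (disp τ)) (allFin n))

  disp≤maxSmallDisp : ∀ j → ¬ Large j → disp τ j ≤ maxSmallDisp
  disp≤maxSmallDisp j j∉L =
    subst (_≤ maxSmallDisp) (restrict-∈ (∁? large?) {disp τ} j∉L) (tabulate⁻ (map⁻ (xs≤max 0 _)) j)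

  maxSmallDisp≤θ : 0ℚ ℚ.≤ θ → ℕ→ℚ maxSmallDisp ℚ.≤ θ
  maxSmallDisp≤θ 0≤θ =
    argmax-all id {P = λ k → ℕ→ℚ k ℚ.≤ θ} 0≤θ (map⁺ (tabulate⁺ (λ j → small≤θ (large? j))))
    where
    small≤θ : ∀ {j} (d : Dec (Large j)) → ℕ→ℚ (if does (¬? d) then disp τ j else 0) ℚ.≤ θ
    small≤θ (yes _) = 0≤θ
    small≤θ (no ¬L) = ℚₚ.≮⇒≥ ¬L

  -- The summand of largeDevSum is local to its where block; unifying largeDevSum θ τ
  -- with its unfolding names it.
  summand : ∀ (s : ℕ) {f : Fin n → ℕ} → s ≡ List.sum (map f (allFin n)) → Fin n → ℕ
  summand _ {f} _ = f

  largeDevSum≡∑ : largeDevSum θ τ ≡ ∑[ i ∈ large? ] disp τ i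
  largeDevSum≡∑ = trans (sum-map-allFin (summand (largeDevSum θ τ) refl)) (sum-cong-≗ pointwise)
    where
    pointwise : ∀ i → summand (largeDevSum θ τ) refl i ≡ restrict large? (disp τ) i
    -- The right-hand side is not abstracted (does (large? i) reduces first), hence eq.
    pointwise i with large? i in eq
    ... | yes _ = cong (λ d → if does d then disp τ i else 0) (sym eq)
    ... | no  _ = cong (λ d → if does d then disp τ i else 0) (sym eq)

lemma2p11 : (n : ℕ) (θ : ℚ) → 0ℚ ℚ.≤ θ → (τ τ̂ : Permutation′ n) →
    IsFiltering θ τ τ̂ →
    (ℕ→ℚ (mdev τ̂ τ) ℚ.≤ ℕ→ℚ 2 ℚ.* θ) × (dev τ̂ ≤ 4 * largeDevSum θ τ)
lemma2p11 n θ 0≤θ τ τ̂ (agree , sorted) = mdev-bound , dev-bound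
  where
  open Filtering (large? θ τ) τ τ̂ agree sorted
  D : ℕ
  D = maxSmallDisp θ τ
  mdev-bound : ℕ→ℚ (mdev τ̂ τ) ℚ.≤ ℕ→ℚ 2 ℚ.* θ
  mdev-bound = begin
    ℕ→ℚ (mdev τ̂ τ)    ≤⟨ ℕ→ℚ-mono-≤ (mdev≤ τ̂ τ (σ-near-τ (disp≤maxSmallDisp θ τ))) ⟩
    ℕ→ℚ (D + D)       ≡⟨ cong (λ k → ℕ→ℚ (D + k)) (+-identityʳ D) ⟨
    ℕ→ℚ (2 * D)       ≡⟨ ℕ→ℚ-homo-* 2 D ⟩
    ℕ→ℚ 2 ℚ.* ℕ→ℚ D   ≤⟨ ℚₚ.*-monoˡ-≤-nonNeg (ℕ→ℚ 2) (maxSmallDisp≤θ θ τ 0≤θ) ⟩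
    ℕ→ℚ 2 ℚ.* θ       ∎
    where open ℚₚ.≤-Reasoning
  dev-bound : dev τ̂ ≤ 4 * largeDevSum θ τ
  dev-bound = begin
    dev τ̂                ≡⟨ sum-map-allFin (disp τ̂) ⟩
    ∑[ i < n ] disp τ̂ i  ≤⟨ ∑-disp-σ≤2∑-large-disp ⟩
    2 * Λ                ≤⟨ *-monoˡ-≤ Λ {2} {4} (s≤s (s≤s z≤n)) ⟩
    4 * Λ                ≡⟨ cong (4 *_) (largeDevSum≡∑ θ τ) ⟨
    4 * largeDevSum θ τ  ∎
    where
    open ≤-Reasoning
    Λ : ℕ
    Λ = ∑[ i ∈ large? θ τ ] disp τ i
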